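{- For any types $A, B$ and any function $f : A \to B$, there are functions (1) $\mathsf{ishadjl}\, f \to \mathsf{ish2adj}\, f$, and (2) $\mathsf{ishadj}\, f \to \mathsf{ish2adjl}\, f$.
   Context: Work in homotopy type theory with univalence and function extensionality. For $f : A \to B$, $f[p]$ denotes $\mathsf{ap}_f\, p$ and $f\llbracket \alpha \rrbracket$ the action of $f$ on a 2-path $\alpha$. $f \sim g$ is $\prod_x fx = gx$. For a homotopy $H : f \sim g$: $H_h :\equiv \lambda c.\,H_{hc}$; $k[H] :\equiv \lambda a.\,k[H_a]$; for $\alpha : H \sim H'$, $k\llbracket\alpha\rrbracket :\equiv \lambda a.\, k\llbracket \alpha_a\rrbracket$. $H \cdot H'$ is pointwise concatenation in diagrammatic order. For $h : X \to Y$, $k : Y \to X$, $H : kh \sim \mathsf{id}_X$, $\mathsf{Coh}\, H : H_{kh} \sim k[h[H]]$ has component at $x$ the naturality path $H_{khx} = (kh)[H_x]$ followed by the functoriality path $(kh)[H_x] = k[h[H_x]]$. Definitions: $\mathsf{ishadj}\, f :\equiv \sum_{g : B \to A} \sum_{\eta : gf \sim \mathsf{id}_A} \sum_{\varepsilon : fg \sim \mathsf{id}_B} (f[\eta] \sim \varepsilon_f)$; $\mathsf{ishadjl}\, f :\equiv \sum_{g : B \to A} \sum_{\eta : gf \sim \mathsf{id}_A} \sum_{\varepsilon : fg \sim \mathsf{id}_B} (\eta_g \sim g[\varepsilon])$; $\mathsf{ish2adj}\, f :\equiv \sum_{g, \eta, \varepsilon} \sum_{\tau : f[\eta] \sim \varepsilon_f}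 \sum_{\theta : \eta_g \sim g[\varepsilon]} (\mathsf{Coh}\, \eta \cdot g\llbracket \tau \rrbracket \sim \theta_f)$; $\mathsf{ish2adjl}\, f :\equiv \sum_{g, \eta, \varepsilon} \sum_{\tau : f[\eta] \sim \varepsilon_f} \sum_{\theta : \eta_g \sim g[\varepsilon]} (\tau_g \cdot \mathsf{Coh}\, \varepsilon \sim f\llbracket \theta \rrbracket)$, with $g : B \to A$, $\eta : gf \sim \mathsf{id}_A$, $\varepsilon : fg \sim \mathsf{id}_B$. -}

{-# OPTIONS --without-K #-}
module Defs where

open import Level using (Level; _⊔_)
open import Function.Base using (_∘_; id)
open import Data.Product using (Σ; Σ-syntax)
open import Relation.Binary.PropositionalEquality
  using (_≡_; refl; trans; cong)
open import Relation.Binary.PropositionalEquality.Properties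
  using (trans-reflʳ; trans-injectiveˡ; cong-∘)

private
  variable
    a b : Level
    X Y A B : Set a

-- homotopies  f ∼ g  :≡  Π x. f x = g x  (for dependent functions, so that
-- homotopies between homotopies make sense)
infix 4 _∼_
_∼_ : {X : Set a} {P : X → Set b} → ((x : X) → P x) → ((x : X) → P x) →
      Set (a ⊔ b)
f ∼ g = ∀ x → f x ≡ g x

infixr 5 _·_
_·_ : {P : X → Set b} {f g h : (x : X) → P x} → f ∼ g → g ∼ h → f ∼ h
(H · H') x = trans (H x) (H' x)

_◃_ : {C : Set a} {P : X → Set b} {f g : (x : X) → P x} → f ∼ g →
      (h : C → X) → (λ c → f (h c)) ∼ (λ c → g (h c))
(H ◃ h) c = H (h c)

ap∼ : {Z : Set a} (k : Y → Z) {f g : X → Y} → f ∼ g → (k ∘ f) ∼ (k ∘ g)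
ap∼ k H x = cong k (H x)

ap2∼ : {Z : Set a} (k : Y → Z) {f g : X → Y} {H H' : f ∼ g} →
       H ∼ H' → ap∼ k H ∼ ap∼ k H'
ap2∼ k α x = cong (cong k) (α x)

nat-id : {f : X → X} (H : f ∼ id) {x y : X} (p : x ≡ y) →
         trans (H x) p ≡ trans (cong f p) (H y)
nat-id H {x} refl = trans-reflʳ (H x)

-- the naturality path  H_{f x} = f[H_x]  (HoTT book Cor. 2.4.4)
nat-path : {f : X → X} (H : f ∼ id) (x : X) → H (f x) ≡ cong f (H x)
nat-path H x = trans-injectiveˡ (H x) (nat-id H (H x))

Coh : (h : X → Y) (k : Y → X) (H : (k ∘ h) ∼ id) →
      (H ◃ (k ∘ h)) ∼ ap∼ k (ap∼ h H)
Coh h k H x = trans (nat-path H x) (cong-∘ (H x))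

ishadj : {A : Set a} {B : Set b} → (A → B) → Set (a ⊔ b)
ishadj {A = A} {B = B} f =
  Σ[ g ∈ (B → A) ] Σ[ η ∈ (g ∘ f) ∼ id ] Σ[ ε ∈ (f ∘ g) ∼ id ]
    (ap∼ f η ∼ (ε ◃ f))

ishadjl : {A : Set a} {B : Set b} → (A → B) → Set (a ⊔ b)
ishadjl {A = A} {B = B} f =
  Σ[ g ∈ (B → A) ] Σ[ η ∈ (g ∘ f) ∼ id ] Σ[ ε ∈ (f ∘ g) ∼ id ]
    ((η ◃ g) ∼ ap∼ g ε)

ish2adj : {A : Set a} {B : Set b} → (A → B) → Set (a ⊔ b)
ish2adj {A = A} {B = B} f =
  Σ[ g ∈ (B → A) ] Σ[ η ∈ (g ∘ f) ∼ id ] Σ[ ε ∈ (f ∘ g) ∼ id ]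
  Σ[ τ ∈ ap∼ f η ∼ (ε ◃ f) ] Σ[ θ ∈ (η ◃ g) ∼ ap∼ g ε ]
    ((Coh f g η · ap2∼ g τ) ∼ (θ ◃ f))

ish2adjl : {A : Set a} {B : Set b} → (A → B) → Set (a ⊔ b)
ish2adjl {A = A} {B = B} f =
  Σ[ g ∈ (B → A) ] Σ[ η ∈ (g ∘ f) ∼ id ] Σ[ ε ∈ (f ∘ g) ∼ id ]
  Σ[ τ ∈ ap∼ f η ∼ (ε ◃ f) ] Σ[ θ ∈ (η ◃ g) ∼ ap∼ g ε ]
    (((τ ◃ g) · Coh g f ε) ∼ ap2∼ f θ)

{-# OPTIONS --without-K #-}
module Submission where

-- If g has a quasi-inverse then so does ap_g on path spaces, and hence so
-- does g⟦–⟧ on 2-paths.  Given θ, the 2-path (Coh η)⁻¹ · θ_f lies in the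
-- image of g⟦–⟧, and its preimage is the required τ; the coherence then
-- holds by construction.  Symmetrically, given τ, the preimage of τ_g · Coh ε
-- under f⟦–⟧ is θ.

open import Defs
open import Level using (Level; _⊔_)
open import Data.Product using (_×_; Σ-syntax; _,_; proj₁; proj₂)
open import Function.Base using (_∘_)
open import Axiom.Extensionality.Propositional using (Extensionality)
open import Relation.Binary.PropositionalEquality
  using (_≡_; refl; trans; sym; cong; module ≡-Reasoning)
open import Relation.Binary.PropositionalEquality.Properties
  using (trans-assoc; trans-symˡ; trans-symʳ; trans-injectiveˡ; trans-injectiveʳ)

private
  variable
    a b : Level
    X Y : Set a

record IsQinv {X : Set a} {Y : Set b} (h : X → Y) : Set (a ⊔ b) where
  field
    inv   : Y → X
    inv-h : ∀ x → inv (h x) ≡ x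
    h-inv : ∀ y → h (inv y) ≡ y
open IsQinv

module _ (h : X → Y) (r : Y → X) (r-h : ∀ x → r (h x) ≡ x) where

  uncong : {x y : X} → h x ≡ h y → x ≡ y
  uncong {x} {y} p = trans (sym (r-h x)) (trans (cong r p) (r-h y))

  uncong-cong : {x y : X} (q : x ≡ y) → uncong (cong h q) ≡ q
  uncong-cong {x} refl = trans-symˡ (r-h x)

  cong-injective : {x y : X} {p q : x ≡ y} → cong h p ≡ cong h q → p ≡ q
  cong-injective {p = p} {q} e =
    trans (sym (uncong-cong p)) (trans (cong uncong e) (uncong-cong q))

conjugate-injective : {A : Set a} {w x y z : A} (d : w ≡ x) (e : y ≡ z)
                      {u v : w ≡ y} →
                      trans (sym d) (trans u e) ≡ trans (sym d) (trans v e) → u ≡ v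
conjugate-injective d e eq = trans-injectiveˡ e (trans-injectiveʳ (sym d) eq)

module _ {h : X → Y} (Q : IsQinv h) where
  open ≡-Reasoning

  -- Both sides have the same image under the injective map cong (inv Q).
  cong-uncong : {x y : X} (p : h x ≡ h y) → cong h (uncong h (inv Q) (inv-h Q) p) ≡ p
  cong-uncong {x} {y} p =
    cong-injective (inv Q) h (h-inv Q)
      (conjugate-injective (inv-h Q x) (inv-h Q y)
        (uncong-cong h (inv Q) (inv-h Q) (uncong h (inv Q) (inv-h Q) p)))

  cong-isQinv : {x y : X} → IsQinv (cong h {x} {y})
  cong-isQinv = record
    { inv   = uncong h (inv Q) (inv-h Q)
    ; inv-h = uncong-cong h (inv Q) (inv-h Q)
    ; h-inv = cong-uncong
    }

  trans-cong-onto : {u : Y} {x y : X} (c : u ≡ h x) (t : u ≡ h y) →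
                    Σ[ β ∈ x ≡ y ] trans c (cong h β) ≡ t
  trans-cong-onto {x = x} {y} c t = β , filled
    where
    β : x ≡ y
    β = uncong h (inv Q) (inv-h Q) (trans (sym c) t)
    filled : trans c (cong h β) ≡ t
    filled = begin
      trans c (cong h β)          ≡⟨ cong (trans c) (cong-uncong (trans (sym c) t)) ⟩
      trans c (trans (sym c) t)   ≡⟨ trans-assoc c ⟨
      trans (trans c (sym c)) t   ≡⟨ cong (λ r → trans r t) (trans-symʳ c) ⟩
      t                           ∎

module _ {A : Set a} {B : Set b} (f : A → B) where

  ishadjl→ish2adj : ishadjl f → ish2adj f
  ishadjl→ish2adj (g , η , ε , θ) = g , η , ε , proj₁ ∘ τ , θ , proj₂ ∘ τ
    where
    τ : ∀ x → Σ[ β ∈ cong f (η x) ≡ ε (f x) ]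
                trans (Coh f g η x) (cong (cong g) β) ≡ θ (f x)
    τ x = trans-cong-onto (cong-isQinv (record { inv = f ; inv-h = ε ; h-inv = η }))
            (Coh f g η x) (θ (f x))

  ishadj→ish2adjl : ishadj f → ish2adjl f
  ishadj→ish2adjl (g , η , ε , τ) = g , η , ε , τ , proj₁ ∘ θ , λ y → sym (proj₂ (θ y))
    where
    θ : ∀ y → Σ[ β ∈ η (g y) ≡ cong g (ε y) ]
                cong (cong f) β ≡ trans (τ (g y)) (Coh g f ε y)
    θ y = trans-cong-onto (cong-isQinv (record { inv = g ; inv-h = η ; h-inv = ε }))
            refl (trans (τ (g y)) (Coh g f ε y))

theorem3p9 : (funext : ∀ {ℓ ℓ'} → Extensionality ℓ ℓ') →
    ∀ {a b : Level} {A : Set a} {B : Set b} (f : A → B) →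
    (ishadjl f → ish2adj f) × (ishadj f → ish2adjl f)
theorem3p9 _ f = ishadjl→ish2adj f , ishadj→ish2adjl f
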